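{- For any $m\in\mathbb{Z}\setminus\{0\}$ and $n\in\mathbb{Z}^+$, we have $$\sum_{k=0}^{n-1}\frac{\binom{2k}{k+1}}{m^k}=\frac{\binom{2n-1}{n-1}}{m^{n-1}}-\frac m2+\frac{m-2}{2}\sum_{k=0}^{n-1}\frac{\binom{2k}{k}}{m^k}.$$ -}

module Defs where

open import Data.Nat using (ℕ; zero; suc)
open import Data.Integer using (ℤ; +_; -[1+_]; +[1+_])
import Data.Integer as ℤ
open import Data.Rational using (ℚ; 0ℚ; 1ℚ; _+_; _*_; _/_; 1/_)
open import Relation.Binary.PropositionalEquality using (_≢_; _≡_; refl)
open import Data.Empty using (⊥-elim)

ℤ→ℚ : ℤ → ℚ
ℤ→ℚ m = m / 1

ℕ→ℚ : ℕ → ℚ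
ℕ→ℚ n = ℤ→ℚ (+ n)

_^ℚ_ : ℚ → ℕ → ℚ
q ^ℚ zero = 1ℚ
q ^ℚ suc k = q * (q ^ℚ k)

sumTo : ℕ → (ℕ → ℚ) → ℚ
sumTo zero f = 0ℚ
sumTo (suc n) f = sumTo n f + f n

inv : (m : ℤ) → m ≢ ℤ.0ℤ → ℚ
inv (+ zero) m≢0 = ⊥-elim (m≢0 refl)
inv +[1+ n ] _ = (+ 1) / suc n
inv -[1+ n ] _ = (ℤ.- (+ 1)) / suc n

-- Write x = 1/m and c(n) = C(2n-1, n-1). Induction on n: passing from n to n + 1 adds
-- C(2n, n+1) x^n on the left, while on the right c(n) x^(n-1) becomes c(n+1) x^n and the
-- second sum gains C(2n, n) x^n. Pascal's rule and the symmetry of binomial coefficients give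
-- C(2n, n) = 2 c(n) and c(n+1) = C(2n, n) + C(2n, n+1), after which the two sides differ by
-- c(n) x^(n-1) (m x - 1) = 0.
module Submission where

open import Defs
open import Data.Nat using (ℕ; zero; suc; NonZero; _∸_; _≤_)
import Data.Nat as ℕ
open import Data.Nat.Properties using (+-suc; +-identityʳ; +-comm; m≤m+n; m+n∸m≡n)
open import Data.Nat.Combinatorics using (_C_; nCk≡nC[n∸k]; nCk+nC[k+1]≡[n+1]C[k+1])
import Data.Nat.Tactic.RingSolver as ℕ-Solver
open import Data.List.Base using (_∷_; [])
open import Data.Integer using (ℤ; 0ℤ; +_; +[1+_]; -[1+_])
import Data.Integer as ℤ
open import Data.Integer.Properties using (pos-+; pos-*)
open import Data.Integer.Tactic.RingSolver using (solve-∀)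
open import Data.Rational using (ℚ; 0ℚ; 1ℚ; _+_; _-_; _*_; ½; fromℚᵘ; toℚᵘ)
open import Data.Rational.Properties
  using (toℚᵘ-injective; toℚᵘ-fromℚᵘ; toℚᵘ-homo-+; toℚᵘ-homo-*; fromℚᵘ-cong; *-identityʳ)
import Data.Rational.Unnormalised as ℚᵘ
import Data.Rational.Unnormalised.Properties as ℚᵘ
import Data.Rational.Solver as ℚ-Solver
open import Relation.Binary.PropositionalEquality
open import Relation.Nullary using (contradiction)

m+k≡n⇒nCm≡nCk : ∀ m k {n} → m ℕ.+ k ≡ n → n C m ≡ n C k
m+k≡n⇒nCm≡nCk m k refl = begin
  (m ℕ.+ k) C m                 ≡⟨ nCk≡nC[n∸k] (m≤m+n m k) ⟩
  (m ℕ.+ k) C (m ℕ.+ k ∸ m)     ≡⟨ cong ((m ℕ.+ k) C_) (m+n∸m≡n m k) ⟩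
  (m ℕ.+ k) C k                 ∎
  where open ≡-Reasoning

2*[1+n]∸1≡1+2*n : ∀ n → 2 ℕ.* suc n ∸ 1 ≡ suc (2 ℕ.* n)
2*[1+n]∸1≡1+2*n n = +-suc n (n ℕ.+ 0)

[2n]Cn≡2*[2n∸1]C[n∸1] : ∀ n .{{_ : NonZero n}} →
  (2 ℕ.* n) C n ≡ 2 ℕ.* ((2 ℕ.* n ∸ 1) C (n ∸ 1))
[2n]Cn≡2*[2n∸1]C[n∸1] (suc k) = begin
  suc N C suc k              ≡⟨ nCk+nC[k+1]≡[n+1]C[k+1] N k ⟨
  N C k ℕ.+ N C suc k        ≡⟨ cong (N C k ℕ.+_) (m+k≡n⇒nCm≡nCk (suc k) k 1+k+k≡N) ⟩
  N C k ℕ.+ N C k            ≡⟨ cong (N C k ℕ.+_) (+-identityʳ (N C k)) ⟨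
  2 ℕ.* (N C k)              ∎
  where
  open ≡-Reasoning
  N : ℕ
  N = 2 ℕ.* suc k ∸ 1
  1+k+k≡N : suc k ℕ.+ k ≡ N
  1+k+k≡N = trans (cong (λ j → suc (k ℕ.+ j)) (sym (+-identityʳ k))) (sym (2*[1+n]∸1≡1+2*n k))

[2n+1]Cn≡[2n]Cn+[2n]C[n+1] : ∀ n →
  (2 ℕ.* suc n ∸ 1) C n ≡ (2 ℕ.* n) C n ℕ.+ (2 ℕ.* n) C (n ℕ.+ 1)
[2n+1]Cn≡[2n]Cn+[2n]C[n+1] zero = refl
[2n+1]Cn≡[2n]Cn+[2n]C[n+1] (suc k) = begin
  (2 ℕ.* suc (suc k) ∸ 1) C suc k   ≡⟨ cong (_C suc k) (2*[1+n]∸1≡1+2*n (suc k)) ⟩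
  suc N C suc k                      ≡⟨ nCk+nC[k+1]≡[n+1]C[k+1] N k ⟨
  N C k ℕ.+ N C suc k                ≡⟨ +-comm (N C k) (N C suc k) ⟩
  N C suc k ℕ.+ N C k                ≡⟨ cong (N C suc k ℕ.+_) (m+k≡n⇒nCm≡nCk k (suc k ℕ.+ 1) k+[k+2]≡N) ⟩
  N C suc k ℕ.+ N C (suc k ℕ.+ 1)    ∎
  where
  open ≡-Reasoning
  N : ℕ
  N = 2 ℕ.* suc k
  k+[k+2]≡N : k ℕ.+ (suc k ℕ.+ 1) ≡ 2 ℕ.* suc k
  k+[k+2]≡N = ℕ-Solver.solve (k ∷ [])

fromℚᵘ-homo-+ : ∀ p q → fromℚᵘ (p ℚᵘ.+ q) ≡ fromℚᵘ p + fromℚᵘ q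
fromℚᵘ-homo-+ p q = toℚᵘ-injective (begin-equality
  toℚᵘ (fromℚᵘ (p ℚᵘ.+ q))              ≃⟨ toℚᵘ-fromℚᵘ (p ℚᵘ.+ q) ⟩
  p ℚᵘ.+ q                              ≃⟨ ℚᵘ.+-cong (toℚᵘ-fromℚᵘ p) (toℚᵘ-fromℚᵘ q) ⟨
  toℚᵘ (fromℚᵘ p) ℚᵘ.+ toℚᵘ (fromℚᵘ q)  ≃⟨ toℚᵘ-homo-+ (fromℚᵘ p) (fromℚᵘ q) ⟨
  toℚᵘ (fromℚᵘ p + fromℚᵘ q)            ∎)
  where open ℚᵘ.≤-Reasoning

fromℚᵘ-homo-* : ∀ p q → fromℚᵘ (p ℚᵘ.* q) ≡ fromℚᵘ p * fromℚᵘ q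
fromℚᵘ-homo-* p q = toℚᵘ-injective (begin-equality
  toℚᵘ (fromℚᵘ (p ℚᵘ.* q))              ≃⟨ toℚᵘ-fromℚᵘ (p ℚᵘ.* q) ⟩
  p ℚᵘ.* q                              ≃⟨ ℚᵘ.*-cong (toℚᵘ-fromℚᵘ p) (toℚᵘ-fromℚᵘ q) ⟨
  toℚᵘ (fromℚᵘ p) ℚᵘ.* toℚᵘ (fromℚᵘ q)  ≃⟨ toℚᵘ-homo-* (fromℚᵘ p) (fromℚᵘ q) ⟨
  toℚᵘ (fromℚᵘ p * fromℚᵘ q)            ∎)
  where open ℚᵘ.≤-Reasoning

ℤ→ℚ-homo-+ : ∀ i j → ℤ→ℚ (i ℤ.+ j) ≡ ℤ→ℚ i + ℤ→ℚ j
ℤ→ℚ-homo-+ i j = trans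
  (fromℚᵘ-cong {ℚᵘ.mkℚᵘ (i ℤ.+ j) 0} {ℚᵘ.mkℚᵘ i 0 ℚᵘ.+ ℚᵘ.mkℚᵘ j 0} (ℚᵘ.*≡* (cross-multiplied i j)))
  (fromℚᵘ-homo-+ (ℚᵘ.mkℚᵘ i 0) (ℚᵘ.mkℚᵘ j 0))
  where
  cross-multiplied : ∀ i j → (i ℤ.+ j) ℤ.* ℤ.1ℤ ≡ (i ℤ.* ℤ.1ℤ ℤ.+ j ℤ.* ℤ.1ℤ) ℤ.* ℤ.1ℤ
  cross-multiplied = solve-∀

ℤ→ℚ-homo-* : ∀ i j → ℤ→ℚ (i ℤ.* j) ≡ ℤ→ℚ i * ℤ→ℚ j
ℤ→ℚ-homo-* i j = fromℚᵘ-homo-* (ℚᵘ.mkℚᵘ i 0) (ℚᵘ.mkℚᵘ j 0)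

ℕ→ℚ-homo-+ : ∀ a b → ℕ→ℚ (a ℕ.+ b) ≡ ℕ→ℚ a + ℕ→ℚ b
ℕ→ℚ-homo-+ a b = trans (cong ℤ→ℚ (pos-+ a b)) (ℤ→ℚ-homo-+ (+ a) (+ b))

ℕ→ℚ-homo-* : ∀ a b → ℕ→ℚ (a ℕ.* b) ≡ ℕ→ℚ a * ℕ→ℚ b
ℕ→ℚ-homo-* a b = trans (cong ℤ→ℚ (pos-* a b)) (ℤ→ℚ-homo-* (+ a) (+ b))

fromℚᵘ-*-inverseʳ : ∀ p .{{_ : ℚᵘ.NonZero p}} → fromℚᵘ p * fromℚᵘ (ℚᵘ.1/ p) ≡ 1ℚ
fromℚᵘ-*-inverseʳ p = trans (sym (fromℚᵘ-homo-* p (ℚᵘ.1/ p))) (fromℚᵘ-cong (ℚᵘ.*-inverseʳ p))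

-- inv m is definitionally fromℚᵘ (ℚᵘ.1/ ℚᵘ.mkℚᵘ m 0), and ℤ→ℚ m is fromℚᵘ (ℚᵘ.mkℚᵘ m 0).
ℤ→ℚ-*-inv : ∀ m (m≢0 : m ≢ 0ℤ) → ℤ→ℚ m * inv m m≢0 ≡ 1ℚ
ℤ→ℚ-*-inv (+ zero)  m≢0 = contradiction refl m≢0
ℤ→ℚ-*-inv +[1+ n ] _ = fromℚᵘ-*-inverseʳ (ℚᵘ.mkℚᵘ +[1+ n ] 0)
ℤ→ℚ-*-inv -[1+ n ] _ = fromℚᵘ-*-inverseʳ (ℚᵘ.mkℚᵘ -[1+ n ] 0)

two : ℚ
two = ℕ→ℚ 2

induction-step : ∀ m x c a X T {b c′ S} →
  m * x ≡ 1ℚ → b ≡ two * c → c′ ≡ b + a →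
  S ≡ c * X - m * ½ + (m - two) * ½ * T →
  S + a * (x * X) ≡ c′ * (x * X) - m * ½ + (m - two) * ½ * (T + b * (x * X))
induction-step m x c a X T m*x≡1 refl refl refl = begin
  c * X - m * ½ + (m - two) * ½ * T + a * (x * X)
    ≡⟨ cong (λ u → u - m * ½ + (m - two) * ½ * T + a * (x * X)) c*X≡c*X*[m*x] ⟩
  c * X * (m * x) - m * ½ + (m - two) * ½ * T + a * (x * X)
    ≡⟨ ring-identity m x c a X T ⟩
  (two * c + a) * (x * X) - m * ½ + (m - two) * ½ * (T + two * c * (x * X))
    ∎
  where
  open ≡-Reasoning
  open ℚ-Solver.+-*-Solver using (solve; _:+_; _:*_; _:-_; con; _:=_)
  c*X≡c*X*[m*x] : c * X ≡ c * X * (m * x)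
  c*X≡c*X*[m*x] = sym (trans (cong (c * X *_) m*x≡1) (*-identityʳ (c * X)))
  ring-identity : ∀ m x c a X T →
    c * X * (m * x) - m * ½ + (m - two) * ½ * T + a * (x * X)
      ≡ (two * c + a) * (x * X) - m * ½ + (m - two) * ½ * (T + two * c * (x * X))
  ring-identity = solve 6 (λ m x c a X T →
    c :* X :* (m :* x) :- m :* con ½ :+ (m :- con two) :* con ½ :* T :+ a :* (x :* X)
      := (con two :* c :+ a) :* (x :* X) :- m :* con ½
         :+ (m :- con two) :* con ½ :* (T :+ con two :* c :* (x :* X))) refl

module _ (m : ℤ) (m≢0 : m ≢ 0ℤ) where
  private
    x : ℚ
    x = inv m m≢0

  sumTo-[2k]C[k+1]-identity : ∀ p →
    sumTo (suc p) (λ k → ℕ→ℚ ((2 ℕ.* k) C (k ℕ.+ 1)) * (x ^ℚ k))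
      ≡ ℕ→ℚ ((2 ℕ.* suc p ∸ 1) C p) * (x ^ℚ p)
        - ℤ→ℚ m * ½
        + (ℤ→ℚ m - two) * ½ * sumTo (suc p) (λ k → ℕ→ℚ ((2 ℕ.* k) C k) * (x ^ℚ k))
  sumTo-[2k]C[k+1]-identity zero = base (ℤ→ℚ m)
    where
    open ℚ-Solver.+-*-Solver using (solve; _:+_; _:*_; _:-_; con; _:=_)
    base : ∀ M → 0ℚ + 0ℚ * 1ℚ ≡ 1ℚ * 1ℚ - M * ½ + (M - two) * ½ * (0ℚ + 1ℚ * 1ℚ)
    base = solve 1 (λ M → con 0ℚ :+ con 0ℚ :* con 1ℚ
      := con 1ℚ :* con 1ℚ :- M :* con ½ :+ (M :- con two) :* con ½ :* (con 0ℚ :+ con 1ℚ :* con 1ℚ)) refl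
  sumTo-[2k]C[k+1]-identity (suc p) =
    induction-step (ℤ→ℚ m) x c a (x ^ℚ p) (sumTo (suc p) (λ k → ℕ→ℚ ((2 ℕ.* k) C k) * (x ^ℚ k)))
      (ℤ→ℚ-*-inv m m≢0) b≡2c c′≡b+a (sumTo-[2k]C[k+1]-identity p)
    where
    c a : ℚ
    c = ℕ→ℚ ((2 ℕ.* suc p ∸ 1) C p)
    a = ℕ→ℚ ((2 ℕ.* suc p) C (suc p ℕ.+ 1))
    b≡2c : ℕ→ℚ ((2 ℕ.* suc p) C suc p) ≡ two * c
    b≡2c = trans (cong ℕ→ℚ ([2n]Cn≡2*[2n∸1]C[n∸1] (suc p))) (ℕ→ℚ-homo-* 2 ((2 ℕ.* suc p ∸ 1) C p))
    c′≡b+a : ℕ→ℚ ((2 ℕ.* suc (suc p) ∸ 1) C suc p) ≡ ℕ→ℚ ((2 ℕ.* suc p) C suc p) + a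
    c′≡b+a = trans (cong ℕ→ℚ ([2n+1]Cn≡[2n]Cn+[2n]C[n+1] (suc p)))
      (ℕ→ℚ-homo-+ ((2 ℕ.* suc p) C suc p) ((2 ℕ.* suc p) C (suc p ℕ.+ 1)))

lemma3p5 : (m : ℤ) (m≢0 : m ≢ 0ℤ) (n : ℕ) → 1 ≤ n →
    sumTo n (λ k → ℕ→ℚ ((2 Data.Nat.* k) C (k Data.Nat.+ 1)) * (inv m m≢0 ^ℚ k))
      ≡ ℕ→ℚ ((2 Data.Nat.* n ∸ 1) C (n ∸ 1)) * (inv m m≢0 ^ℚ (n ∸ 1))
        - ℤ→ℚ m * ½
        + (ℤ→ℚ m - ℤ→ℚ (Data.Integer.+ 2)) * ½
          * sumTo n (λ k → ℕ→ℚ ((2 Data.Nat.* k) C k) * (inv m m≢0 ^ℚ k))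
lemma3p5 m m≢0 (suc p) _ = sumTo-[2k]C[k+1]-identity m m≢0 p
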